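{- If $\mathcal{F}=(V,\mathcal{E})$ is a semicycle-free $k$-uniform hypergraph with $n$ vertices and $m$ edges, then $m\leq \binom{n}{k-1}$.
   Context: Hypergraphs are finite, $k$-uniform and have no multiple edges. A nonempty $k$-uniform hypergraph $\mathcal{C}$ is a semicycle if there is a sequence $v_1,\dots,v_l$ of its vertices in which every vertex of $\mathcal{C}$ appears at least once (possibly several times), $v_1=v_l$, and the sets $\{v_i,\dots,v_{i+k-1}\}$ for $1\le i\le l-k+1$ are pairwise distinct edges of $\mathcal{C}$ and are exactly its edges. A hypergraph is semicycle-free if it contains no subhypergraph that is a semicycle. -}

module Defs where

open import Data.Nat using (ℕ; zero; suc; _≤?_)
open import Data.List using (List; []; _∷_; length; take; head; last; map; foldr)
open import Data.List.Relation.Unary.All using (All)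
open import Data.List.Relation.Unary.Any using (Any)
open import Data.List.Relation.Unary.Unique.Propositional using (Unique)
open import Data.List.Membership.Propositional using (_∈_)
open import Data.Fin using (Fin)
open import Data.Fin.Subset using (Subset; ⊥; ⁅_⁆; _∪_; ∣_∣)
open import Data.Product using (Σ; _×_; ∃-syntax)
open import Relation.Nullary using (does; ¬_)
open import Data.Bool using (if_then_else_)
open import Relation.Binary.PropositionalEquality using (_≡_)

record Hypergraph (n k : ℕ) : Set where
  field
    edges   : List (Subset n)
    uniform : All (λ e → ∣ e ∣ ≡ k) edges
    simple  : Unique edges
open Hypergraph public

numEdges : ∀ {n k} → Hypergraph n k → ℕ
numEdges H = length (edges H)

toSubset : ∀ {n} → List (Fin n) → Subset n
toSubset = foldr (λ v s → ⁅ v ⁆ ∪ s) ⊥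

-- all contiguous blocks (v_i, ..., v_{i+k-1}), 1 ≤ i ≤ l-k+1, of a list of length l
windows : ∀ {A : Set} → ℕ → List A → List (List A)
windows zero    []       = [] ∷ []
windows (suc k) []       = []
windows k (x ∷ xs) =
  if does (k ≤? length (x ∷ xs)) then take k (x ∷ xs) ∷ windows k xs else []

windowEdges : ∀ {n} → ℕ → List (Fin n) → List (Subset n)
windowEdges k vs = map toSubset (windows k vs)

-- H contains a semicycle as a subhypergraph: there is a vertex sequence
-- v_1,...,v_l with v_1 = v_l whose k-windows form a nonempty family of
-- pairwise distinct sets, all of which are edges of H.  (The semicycle is
-- the hypergraph formed by these windows; its vertices are exactly the v_i.)
ContainsSemicycle : ∀ {n k} → Hypergraph n k → Set
ContainsSemicycle {n} {k} H =
  ∃[ vs ] (head vs ≡ last vs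
          × Any (λ _ → Data.Unit.⊤) (windowEdges k vs)
          × Unique (windowEdges k vs)
          × All (λ w → w ∈ edges H) (windowEdges k vs))
  where import Data.Unit

SemicycleFree : ∀ {n k} → Hypergraph n k → Set
SemicycleFree H = ¬ ContainsSemicycle H

-- Induction on the number of edges, producing as many distinct (k-1)-sets as there are edges.
-- Call v pendant in the edge e if e - v lies in no other edge. If some edge e has a pendant
-- vertex v, delete e and add e - v to the family obtained for the remaining edges: it is new,
-- because every set found so far lies below a remaining edge. Otherwise every (k-1)-subset of an
-- edge lies in a second edge, and a tight path can be prolonged forever: if its leading window
-- is the edge e and u is e minus its last vertex, the second edge through u is u plus a vertex x
-- outside e, and x is put in front. The path eventually meets a vertex again, and cutting it there
-- closes it into a semicycle (for k = 1 a single edge already is one). Distinct (k-1)-sets are at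
-- most C(n, k-1) in number, by Pascal's rule.

module Submission where

open import Defs
open import Data.Nat using (ℕ; _≤_; _∸_)
open import Data.Nat.Combinatorics using (_C_)

open import Data.Nat.Base using (zero; suc; _+_; _<_; _<ᵇ_; z≤n; s≤s)
open import Data.Nat.Properties
  using (_≤?_; ≤-refl; ≤-reflexive; ≤-trans; ≤⇒≯; <⇒≱; 1+n≰n; n≤1+n; m≤n⇒m≤1+n; m≤n⇒m⊓n≡m;
         suc-injective; ≰⇒>; +-suc; +-mono-≤; m∸n+n≡m; ≤⇒≤ᵇ; ≤ᵇ⇒≤; module ≤-Reasoning)
open import Data.Nat.Combinatorics using (nCk+nC[k+1]≡[n+1]C[k+1])
open import Data.Bool.Base using (true; false; T)
open import Data.Bool.Properties using () renaming (_≟_ to _≟ᵇ_)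
open import Data.Empty using (⊥-elim)
open import Data.Unit using (⊤; tt)
open import Data.Product using (∃; ∃₂; ∃-syntax; _×_; _,_; proj₂)
open import Data.Sum using (_⊎_; inj₁; inj₂; [_,_]′)
open import Data.Maybe using (just)
open import Data.Fin.Base using (Fin; zero; suc)
open import Data.Fin.Properties using (¬∀⟶∃¬) renaming (_≟_ to _≟ᶠ_)
open import Data.Fin.Subset
  using (Subset; Side; inside; outside; ⁅_⁆; _∪_; _-_; ∣_∣; _⊆_)
  renaming (_∈_ to _∈ₛ_; _∉_ to _∉ₛ_)
open import Data.Fin.Subset.Properties
  using (_∈?_; _⊆?_; ⊆-antisym; ∉⊥; ∣⊥∣≡0; ∣p∣≤n; x∈⁅x⁆; x∈⁅y⁆⇒x≡y; x∈p∪q⁺; x∈p∪q⁻;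
         ∪-identityˡ; p─⊥≡p; p─q⊆p; x∈p∧x≢y⇒x∈p-y; p⊆q⇒∣p∣≤∣q∣; p⊂q⇒∣p∣<∣q∣)
open import Data.Vec.Base using ([]; _∷_; here; there)
open import Data.Vec.Properties using (≡-dec)
open import Data.List.Base
  using (List; []; _∷_; head; length; take; _++_; [_]; map; last; allFin; filter)
open import Data.List.Properties using (length-take; length-++-≤ˡ; take-all; ++-assoc)
open import Data.List.Membership.Propositional using (_∈_; _∉_; find; lose)
open import Data.List.Membership.Propositional.Properties
  using (∈-++⁺ˡ; ∈-++⁺ʳ; ∈-++⁻; ∈-∃++; ∈-map⁻; ∈-allFin; ∈-filter⁺; ∈-filter⁻)
open import Data.List.Relation.Binary.Subset.Propositional.Properties using (Any-resp-⊆; All-resp-⊇)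
open import Data.List.Relation.Unary.All as All using (All; []; _∷_)
open import Data.List.Relation.Unary.All.Properties
  using (¬Any⇒All¬; All¬⇒¬Any; ¬All⇒Any¬; ++⁺; ++⁻ˡ; ++⁻ʳ; map⁺)
open import Data.List.Relation.Unary.Any as Any using (Any; here; there)
open import Data.List.Relation.Unary.AllPairs using ([]; _∷_)
open import Data.List.Relation.Unary.Unique.Propositional using (Unique)
open import Data.List.Relation.Unary.Unique.Propositional.Properties using (take⁺; filter⁺; allFin⁺)
open import Function.Base using (_∘_)
open import Relation.Nullary using (¬_; Dec; yes; no)
open import Relation.Nullary.Decidable using (decidable-stable; _×-dec_; _→-dec_)
open import Relation.Binary.PropositionalEquality
  using (_≡_; _≢_; refl; sym; trans; cong; cong₂; subst; module ≡-Reasoning)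

∣⁅x⁆∪p∣≡1+∣p∣ : ∀ {n} {x : Fin n} {p : Subset n} → x ∉ₛ p → ∣ ⁅ x ⁆ ∪ p ∣ ≡ suc ∣ p ∣
∣⁅x⁆∪p∣≡1+∣p∣ {x = zero}  {inside  ∷ p} x∉p = ⊥-elim (x∉p here)
∣⁅x⁆∪p∣≡1+∣p∣ {x = zero}  {outside ∷ p} _   = cong (suc ∘ ∣_∣) (∪-identityˡ p)
∣⁅x⁆∪p∣≡1+∣p∣ {x = suc x} {inside  ∷ p} x∉p = cong suc (∣⁅x⁆∪p∣≡1+∣p∣ (x∉p ∘ there))
∣⁅x⁆∪p∣≡1+∣p∣ {x = suc x} {outside ∷ p} x∉p = ∣⁅x⁆∪p∣≡1+∣p∣ (x∉p ∘ there)

x∈p⇒1+∣p-x∣≡∣p∣ : ∀ {n} {x : Fin n} {p : Subset n} → x ∈ₛ p → suc ∣ p - x ∣ ≡ ∣ p ∣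
x∈p⇒1+∣p-x∣≡∣p∣ {x = zero}  {inside  ∷ p} here        = cong (suc ∘ ∣_∣) (p─⊥≡p p)
x∈p⇒1+∣p-x∣≡∣p∣ {x = suc x} {inside  ∷ p} (there x∈p) = cong suc (x∈p⇒1+∣p-x∣≡∣p∣ x∈p)
x∈p⇒1+∣p-x∣≡∣p∣ {x = suc x} {outside ∷ p} (there x∈p) = x∈p⇒1+∣p-x∣≡∣p∣ x∈p

⁅x⁆∪p⊆q : ∀ {n} {x : Fin n} {p q : Subset n} → x ∈ₛ q → p ⊆ q → ⁅ x ⁆ ∪ p ⊆ q
⁅x⁆∪p⊆q {x = x} {p} {q} x∈q p⊆q y∈ =
  [ (λ y∈⁅x⁆ → subst (_∈ₛ q) (sym (x∈⁅y⁆⇒x≡y x y∈⁅x⁆)) x∈q) , p⊆q ]′ (x∈p∪q⁻ ⁅ x ⁆ p y∈)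

⊈⇒∃∈∖ : ∀ {n} {p q : Subset n} → ¬ (q ⊆ p) → ∃[ x ] (x ∈ₛ q × x ∉ₛ p)
⊈⇒∃∈∖ {n} {p} {q} q⊈p =
  let x , ¬[x∈q→x∈p] = ¬∀⟶∃¬ n _ (λ x → (x ∈? q) →-dec (x ∈? p)) (λ q⊆p → q⊈p (q⊆p _))
  in x , decidable-stable (x ∈? q) (λ x∉q → ¬[x∈q→x∈p] (⊥-elim ∘ x∉q))
       , (λ x∈p → ¬[x∈q→x∈p] (λ _ → x∈p))

∣p∣<∣q∣⇒∃∈∖ : ∀ {n} {p q : Subset n} → ∣ p ∣ < ∣ q ∣ → ∃[ x ] (x ∈ₛ q × x ∉ₛ p)
∣p∣<∣q∣⇒∃∈∖ ∣p∣<∣q∣ = ⊈⇒∃∈∖ (λ q⊆p → <⇒≱ ∣p∣<∣q∣ (p⊆q⇒∣p∣≤∣q∣ q⊆p))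

⊆∧∣q∣≤∣p∣⇒≡ : ∀ {n} {p q : Subset n} → p ⊆ q → ∣ q ∣ ≤ ∣ p ∣ → p ≡ q
⊆∧∣q∣≤∣p∣⇒≡ {p = p} {q} p⊆q ∣q∣≤∣p∣ = ⊆-antisym p⊆q
  (decidable-stable (q ⊆? p) (λ q⊈p → ≤⇒≯ ∣q∣≤∣p∣ (p⊂q⇒∣p∣<∣q∣ (p⊆q , ⊈⇒∃∈∖ q⊈p))))

∈-toSubset⁺ : ∀ {n} {x : Fin n} {xs} → x ∈ xs → x ∈ₛ toSubset xs
∈-toSubset⁺ {xs = y ∷ _} (here refl) = x∈p∪q⁺ (inj₁ (x∈⁅x⁆ y))
∈-toSubset⁺ (there x∈xs)             = x∈p∪q⁺ (inj₂ (∈-toSubset⁺ x∈xs))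

∈-toSubset⁻ : ∀ {n} {x : Fin n} xs → x ∈ₛ toSubset xs → x ∈ xs
∈-toSubset⁻ []       x∈∅ = ⊥-elim (∉⊥ x∈∅)
∈-toSubset⁻ (y ∷ ys) x∈  =
  [ here ∘ x∈⁅y⁆⇒x≡y y , there ∘ ∈-toSubset⁻ ys ]′ (x∈p∪q⁻ ⁅ y ⁆ (toSubset ys) x∈)

∈-resp-toSubset : ∀ {n} {x : Fin n} xs {ys} → toSubset xs ≡ toSubset ys → x ∈ xs → x ∈ ys
∈-resp-toSubset _ {ys} eq = ∈-toSubset⁻ ys ∘ subst (_ ∈ₛ_) eq ∘ ∈-toSubset⁺

∣toSubset∣≡length : ∀ {n} {xs : List (Fin n)} → Unique xs → ∣ toSubset xs ∣ ≡ length xs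
∣toSubset∣≡length {n} {[]}     _          = ∣⊥∣≡0 n
∣toSubset∣≡length {xs = x ∷ xs} (x∉xs ∷ u) =
  trans (∣⁅x⁆∪p∣≡1+∣p∣ (All¬⇒¬Any x∉xs ∘ ∈-toSubset⁻ xs)) (cong suc (∣toSubset∣≡length u))

Unique⇒length≤ : ∀ {n} {xs : List (Fin n)} → Unique xs → length xs ≤ n
Unique⇒length≤ {xs = xs} u = subst (_≤ _) (∣toSubset∣≡length u) (∣p∣≤n (toSubset xs))

listing : ∀ {n} (e : Subset n) → ∃[ xs ] (Unique xs × toSubset xs ≡ e)
listing {n} e = filter (_∈? e) (allFin n) , filter⁺ (_∈? e) (allFin⁺ n) , ⊆-antisym
  (λ x∈ → proj₂ (∈-filter⁻ (_∈? e) {xs = allFin n} (∈-toSubset⁻ _ x∈)))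
  (λ x∈e → ∈-toSubset⁺ (∈-filter⁺ (_∈? e) (∈-allFin _) x∈e))

module _ {A : Set} where

  ∈-take⁻ : ∀ m {xs : List A} {x} → x ∈ take m xs → x ∈ xs
  ∈-take⁻ (suc m) {_ ∷ _} (here eq)  = here eq
  ∈-take⁻ (suc m) {_ ∷ _} (there x∈) = there (∈-take⁻ m x∈)

  ∈-take-suc : ∀ m {xs : List A} {x} → x ∈ take m xs → x ∈ take (suc m) xs
  ∈-take-suc (suc m) {_ ∷ _} (here eq)  = here eq
  ∈-take-suc (suc m) {_ ∷ _} (there x∈) = there (∈-take-suc m x∈)

  take-++ : ∀ m (xs ys : List A) → m ≤ length xs → take m (xs ++ ys) ≡ take m xs
  take-++ zero    xs       ys _         = refl
  take-++ (suc m) (x ∷ xs) ys (s≤s m≤n) = cong (x ∷_) (take-++ m xs ys m≤n)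

  length-take-≤ : ∀ m {xs : List A} → m ≤ length xs → length (take m xs) ≡ m
  length-take-≤ m {xs} m≤n = trans (length-take m xs) (m≤n⇒m⊓n≡m m≤n)

  ∉take⇒≤length : ∀ m (xs : List A) {x ys} → x ∉ take m (xs ++ x ∷ ys) → m ≤ length xs
  ∉take⇒≤length zero    xs       _  = z≤n
  ∉take⇒≤length (suc m) []       x∉ = ⊥-elim (x∉ (here refl))
  ∉take⇒≤length (suc m) (_ ∷ xs) x∉ = s≤s (∉take⇒≤length m xs (x∉ ∘ there))

  last-∷ʳ : ∀ (x : A) xs y → last (x ∷ xs ++ [ y ]) ≡ just y
  last-∷ʳ x []       y = refl
  last-∷ʳ x (z ∷ zs) y = last-∷ʳ z zs y

  ∃∈-nonempty : ∀ {xs : List A} {m} → length xs ≡ suc m → ∃ (_∈ xs)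
  ∃∈-nonempty {x ∷ _} _ = x , here refl

  ⊆-insert : ∀ xs {y ys} {z : A} → z ∈ xs ++ ys → z ∈ xs ++ y ∷ ys
  ⊆-insert xs = [ ∈-++⁺ˡ , ∈-++⁺ʳ xs ∘ there ]′ ∘ ∈-++⁻ xs

  length-insert : ∀ xs {y : A} {ys} → length (xs ++ y ∷ ys) ≡ suc (length (xs ++ ys))
  length-insert []       = refl
  length-insert (_ ∷ xs) = cong suc (length-insert xs)

  Unique-++⁻ˡ : ∀ xs {ys : List A} → Unique (xs ++ ys) → Unique xs
  Unique-++⁻ˡ []       _          = []
  Unique-++⁻ˡ (_ ∷ xs) (x∉ ∷ u) = ++⁻ˡ xs x∉ ∷ Unique-++⁻ˡ xs u

  Unique-remove : ∀ xs {y : A} {ys} → Unique (xs ++ y ∷ ys) → Unique (xs ++ ys)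
  Unique-remove []       (_ ∷ u)  = u
  Unique-remove (_ ∷ xs) (x∉ ∷ u) = ++⁺ (++⁻ˡ xs x∉) (All.tail (++⁻ʳ xs x∉)) ∷ Unique-remove xs u

  Unique-removed : ∀ xs {y : A} {ys} → Unique (xs ++ y ∷ ys) → y ∉ xs ++ ys
  Unique-removed []       (y∉ ∷ _) = All¬⇒¬Any y∉
  Unique-removed (_ ∷ xs) (x∉ ∷ _) (here refl) = All¬⇒¬Any x∉ (∈-++⁺ʳ xs (here refl))
  Unique-removed (_ ∷ xs) (_ ∷ u)  (there y∈)  = Unique-removed xs u y∈

-- windows (suc j) (x ∷ xs) reduces to a conditional on j <ᵇ suc (length xs).
module _ {A : Set} (j : ℕ) where

  windows-∷ : ∀ (x : A) xs → suc j ≤ length (x ∷ xs) →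
              windows (suc j) (x ∷ xs) ≡ take (suc j) (x ∷ xs) ∷ windows (suc j) xs
  windows-∷ x xs long with j <ᵇ suc (length xs) in eq
  ... | true  = refl
  ... | false = ⊥-elim (subst T eq (≤⇒≤ᵇ long))

  windows-short : ∀ (xs : List A) → length xs < suc j → windows (suc j) xs ≡ []
  windows-short []       _     = refl
  windows-short (x ∷ xs) short with j <ᵇ suc (length xs) in eq
  ... | true  = ⊥-elim (≤⇒≯ (≤ᵇ⇒≤ (suc j) (length (x ∷ xs)) (subst T (sym eq) tt)) short)
  ... | false = refl

  ∈-windows-∷⁻ : ∀ {x : A} {xs w} → w ∈ windows (suc j) (x ∷ xs) →
                 suc j ≤ length (x ∷ xs) × (w ≡ take (suc j) (x ∷ xs) ⊎ w ∈ windows (suc j) xs)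
  ∈-windows-∷⁻ {x} {xs} w∈ with j <ᵇ suc (length xs) in eq | w∈
  ... | true | w∈′ = ≤ᵇ⇒≤ (suc j) (length (x ∷ xs)) (subst T (sym eq) tt) , Any.toSum w∈′

  take-∈-windows : ∀ {xs : List A} → suc j ≤ length xs → take (suc j) xs ∈ windows (suc j) xs
  take-∈-windows {x ∷ xs} long =
    subst (take (suc j) (x ∷ xs) ∈_) (sym (windows-∷ x xs long)) (here refl)

  windows-single : ∀ {xs : List A} → length xs ≡ suc j → windows (suc j) xs ≡ xs ∷ []
  windows-single {x ∷ xs} refl = trans (windows-∷ x xs ≤-refl)
    (cong₂ _∷_ (cong (x ∷_) (take-all j xs ≤-refl)) (windows-short xs ≤-refl))

  windows-⊆ : ∀ (xs : List A) {w x} → w ∈ windows (suc j) xs → x ∈ w → x ∈ xs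
  windows-⊆ (y ∷ ys) w∈ x∈w with ∈-windows-∷⁻ w∈
  ... | _ , inj₁ refl = ∈-take⁻ (suc j) x∈w
  ... | _ , inj₂ w∈′  = there (windows-⊆ ys w∈′ x∈w)

  windows-++⁺ : ∀ (xs : List A) {ys w} → w ∈ windows (suc j) xs → w ∈ windows (suc j) (xs ++ ys)
  windows-++⁺ (x ∷ xs) {ys} w∈ with ∈-windows-∷⁻ w∈
  ... | long , w≡⊎w∈ =
    subst (_ ∈_) (sym (windows-∷ x (xs ++ ys) (≤-trans long (length-++-≤ˡ (x ∷ xs)))))
      ([ (λ { refl → here (sym (take-++ (suc j) (x ∷ xs) ys long)) }) , there ∘ windows-++⁺ xs ]′
         w≡⊎w∈)

windowEdges-unique : ∀ {n} j {xs : List (Fin n)} → Unique xs → Unique (windowEdges (suc j) xs)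
windowEdges-unique j {[]}     _          = []
windowEdges-unique j {x ∷ xs} (x∉xs ∷ u) with suc j ≤? length (x ∷ xs)
... | no short =
  subst (Unique ∘ map toSubset) (sym (windows-short j (x ∷ xs) (≰⇒> short))) []
... | yes long =
  subst (Unique ∘ map toSubset) (sym (windows-∷ j x xs long))
    (¬Any⇒All¬ _ first∉ ∷ windowEdges-unique j u)
  where
  first∉ : toSubset (take (suc j) (x ∷ xs)) ∉ windowEdges (suc j) xs
  first∉ e∈ =
    let w , w∈ , e≡ = ∈-map⁻ toSubset e∈
    in All¬⇒¬Any x∉xs
         (windows-⊆ j xs w∈ (∈-resp-toSubset (take (suc j) (x ∷ xs)) e≡ (here refl)))

-- The first window x y … contains y, which no later window of the repetition-free y ∷ ys does.
windowEdges-∷-unique : ∀ {n} i {x y : Fin n} {ys} → Unique (y ∷ ys) →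
  suc (suc i) ≤ length (y ∷ ys) → x ∉ take (suc (suc i)) (y ∷ ys) →
  Unique (windowEdges (suc (suc i)) (x ∷ y ∷ ys))
windowEdges-∷-unique i {x} {y} {ys} u@(y∉ys ∷ _) long x∉ =
  subst (Unique ∘ map toSubset) (sym (windows-∷ (suc i) x (y ∷ ys) (m≤n⇒m≤1+n long)))
    (¬Any⇒All¬ _ first∉ ∷ windowEdges-unique (suc i) u)
  where
  first∉ : toSubset (x ∷ take (suc i) (y ∷ ys)) ∉ windowEdges (suc (suc i)) (y ∷ ys)
  first∉ e∈ with ∈-map⁻ toSubset e∈
  ... | w , w∈ , e≡ with ∈-windows-∷⁻ (suc i) w∈
  ...   | _ , inj₁ refl = x∉ (∈-resp-toSubset (x ∷ take (suc i) (y ∷ ys)) e≡ (here refl))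
  ...   | _ , inj₂ w∈′  = All¬⇒¬Any y∉ys
    (windows-⊆ (suc i) ys w∈′ (∈-resp-toSubset (x ∷ take (suc i) (y ∷ ys)) e≡ (there (here refl))))

-- Semicycles and tight paths

IsSemicycle : ∀ {n} → ℕ → List (Subset n) → List (Fin n) → Set
IsSemicycle k E vs =
  head vs ≡ last vs × Any (λ _ → ⊤) (windowEdges k vs) ×
  Unique (windowEdges k vs) × All (_∈ E) (windowEdges k vs)

HasSemicycle : ∀ {n} → ℕ → List (Subset n) → Set
HasSemicycle k E = ∃ (IsSemicycle k E)

record TightPath {n} (j : ℕ) (E : List (Subset n)) (D : List (Fin n)) : Set where
  field
    distinct : Unique D
    long     : suc j ≤ length D
    onEdges  : All (λ w → toSubset w ∈ E) (windows (suc j) D)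

  firstEdge : toSubset (take (suc j) D) ∈ E
  firstEdge = All.lookup onEdges (take-∈-windows j {D} long)

open TightPath

TightPath-∷ : ∀ {n j E} {D : List (Fin n)} {x} → TightPath j E D → x ∉ D →
              toSubset (x ∷ take j D) ∈ E → TightPath j E (x ∷ D)
TightPath-∷ {j = j} {E} {D} {x} path x∉D edge = record
  { distinct = ¬Any⇒All¬ _ x∉D ∷ distinct path
  ; long     = m≤n⇒m≤1+n (long path)
  ; onEdges  = subst (All (λ w → toSubset w ∈ E))
                 (sym (windows-∷ j x D (m≤n⇒m≤1+n (long path)))) (edge ∷ onEdges path)
  }

edge⇒TightPath : ∀ {n j E} {e : Subset n} → e ∈ E → ∣ e ∣ ≡ suc j → ∃ (TightPath j E)
edge⇒TightPath {j = j} {E} {e} e∈E ∣e∣≡k =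
  let D , distinct , D≡e = listing e
      length≡ = trans (sym (∣toSubset∣≡length distinct)) (trans (cong ∣_∣ D≡e) ∣e∣≡k)
  in D , record
    { distinct = distinct
    ; long     = ≤-reflexive (sym length≡)
    ; onEdges  = subst (All (λ w → toSubset w ∈ E)) (sym (windows-single j {D} length≡))
                   (subst (_∈ E) (sym D≡e) e∈E ∷ [])
    }

SharedRidges : ∀ {n} → List (Subset n) → Set
SharedRidges E = ∀ {e} → e ∈ E → ∀ {v} → v ∈ₛ e → ∃[ f ] (f ∈ E × f ≢ e × e - v ⊆ f)

module Ridges {n j} {E : List (Subset n)}
  (uniform : All (λ e → ∣ e ∣ ≡ suc j) E) (shared : SharedRidges E) where

  ridge-extension : ∀ {e u} → e ∈ E → u ⊆ e → ∣ u ∣ ≡ j → ∃[ x ] (x ∉ₛ e × ⁅ x ⁆ ∪ u ∈ E)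
  ridge-extension {e} {u} e∈E u⊆e ∣u∣≡j =
    let v , v∈e , v∉u        = ∣p∣<∣q∣⇒∃∈∖ (∣u∣<edge e∈E)
        f , f∈E , f≢e , e-v⊆f = shared e∈E v∈e
        u⊆f : u ⊆ f
        u⊆f y∈u = e-v⊆f (x∈p∧x≢y⇒x∈p-y (u⊆e y∈u) λ { refl → v∉u y∈u })
        x , x∈f , x∉u        = ∣p∣<∣q∣⇒∃∈∖ (∣u∣<edge f∈E)
        fills : ∀ {g} → g ∈ E → x ∈ₛ g → u ⊆ g → ⁅ x ⁆ ∪ u ≡ g
        fills {g} g∈E x∈g u⊆g = ⊆∧∣q∣≤∣p∣⇒≡ (⁅x⁆∪p⊆q x∈g u⊆g) (≤-reflexive (begin
          ∣ g ∣           ≡⟨ All.lookup uniform g∈E ⟩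
          suc j           ≡⟨ cong suc ∣u∣≡j ⟨
          suc ∣ u ∣       ≡⟨ ∣⁅x⁆∪p∣≡1+∣p∣ x∉u ⟨
          ∣ ⁅ x ⁆ ∪ u ∣   ∎))
    in x , (λ x∈e → f≢e (trans (sym (fills f∈E x∈f u⊆f)) (fills e∈E x∈e u⊆e)))
         , subst (_∈ E) (sym (fills f∈E x∈f u⊆f)) f∈E
    where
    open ≡-Reasoning
    ∣u∣<edge : ∀ {f} → f ∈ E → ∣ u ∣ < ∣ f ∣
    ∣u∣<edge f∈E =
      subst (suc ∣ u ∣ ≤_) (sym (All.lookup uniform f∈E)) (s≤s (≤-reflexive ∣u∣≡j))

  extend : ∀ {D} → TightPath j E D → ∃[ x ] (x ∉ take (suc j) D × toSubset (x ∷ take j D) ∈ E)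
  extend {D} path =
    let x , x∉e , edge = ridge-extension (firstEdge path) prefix⊆ ∣prefix∣≡j
    in x , x∉e ∘ ∈-toSubset⁺ , edge
    where
    prefix⊆ : toSubset (take j D) ⊆ toSubset (take (suc j) D)
    prefix⊆ = ∈-toSubset⁺ ∘ ∈-take-suc j ∘ ∈-toSubset⁻ (take j D)
    ∣prefix∣≡j : ∣ toSubset (take j D) ∣ ≡ j
    ∣prefix∣≡j = trans (∣toSubset∣≡length (take⁺ j (distinct path)))
                       (length-take-≤ j (≤-trans (n≤1+n j) (long path)))

closeUp : ∀ {n i E} P {x : Fin n} {Q D} → D ≡ P ++ x ∷ Q → TightPath (suc i) E D →
          x ∉ take (suc (suc i)) D → toSubset (x ∷ take (suc i) D) ∈ E →
          HasSemicycle (suc (suc i)) E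
closeUp []      refl _    x∉ _    = ⊥-elim (x∉ (here refl))
closeUp {i = i} {E} (p ∷ P) {x} {Q} refl path x∉ edge =
  x ∷ cyc , sym (last-∷ʳ x (p ∷ P) x)
        , subst (Any _) (sym windows-cycle) (here tt)
        , windowEdges-∷-unique i cyc-distinct k≤cyc x∉take
        , subst (All (_∈ E)) (sym windows-cycle) (first ∷ map⁺ rest)
  where
  k = suc (suc i)
  cyc = p ∷ P ++ [ x ]
  cyc++Q≡ : cyc ++ Q ≡ p ∷ P ++ x ∷ Q
  cyc++Q≡ = ++-assoc (p ∷ P) [ x ] Q
  k≤P : k ≤ length (p ∷ P)
  k≤P = ∉take⇒≤length k (p ∷ P) x∉
  k≤cyc : k ≤ length cyc
  k≤cyc = ≤-trans k≤P (length-++-≤ˡ (p ∷ P))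
  cyc-distinct : Unique cyc
  cyc-distinct = Unique-++⁻ˡ cyc (subst Unique (sym cyc++Q≡) (distinct path))
  x∉take : x ∉ take k cyc
  x∉take = Unique-removed (p ∷ P) (distinct path) ∘ ∈-++⁺ˡ ∘ ∈-take⁻ k
         ∘ subst (x ∈_) (take-++ k (p ∷ P) [ x ] k≤P)
  windows-cycle : windowEdges k (x ∷ cyc) ≡ toSubset (x ∷ take (suc i) cyc) ∷ windowEdges k cyc
  windows-cycle = cong (map toSubset) (windows-∷ (suc i) x cyc (m≤n⇒m≤1+n k≤cyc))
  first : toSubset (x ∷ take (suc i) cyc) ∈ E
  first = subst (λ w → toSubset (x ∷ w) ∈ E)
    (trans (take-++ (suc i) (p ∷ P) (x ∷ Q) (≤-trans (n≤1+n _) k≤P))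
           (sym (take-++ (suc i) (p ∷ P) [ x ] (≤-trans (n≤1+n _) k≤P))))
    edge
  rest : All (λ w → toSubset w ∈ E) (windows k cyc)
  rest = All-resp-⊇ (windows-++⁺ (suc i) cyc)
    (subst (λ D → All (λ w → toSubset w ∈ E) (windows k D)) (sym cyc++Q≡) (onEdges path))

module _ {n i} {E : List (Subset n)}
  (uniform : All (λ e → ∣ e ∣ ≡ suc (suc i)) E) (shared : SharedRidges E) where

  open Ridges uniform shared using (extend)

  -- The path grows at its front until the new vertex repeats; s bounds the steps left.
  walk : ∀ s {D} → n ≡ s + length D → TightPath (suc i) E D → HasSemicycle (suc (suc i)) E
  grow : ∀ s {D x} → n ≡ s + length D → TightPath (suc i) E D → x ∉ take (suc (suc i)) D →
         toSubset (x ∷ take (suc i) D) ∈ E → Dec (x ∈ D) → HasSemicycle (suc (suc i)) E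

  walk s {D} n≡ path =
    let x , x∉window , edge = extend path in grow s n≡ path x∉window edge (Any.any? (x ≟ᶠ_) D)

  grow s       n≡ path x∉window edge (yes x∈D) =
    let P , Q , D≡ = ∈-∃++ x∈D in closeUp P D≡ path x∉window edge
  grow zero    {D} n≡ path _ _    (no x∉D) = ⊥-elim (1+n≰n
    (subst (suc (length D) ≤_) n≡ (Unique⇒length≤ (¬Any⇒All¬ _ x∉D ∷ distinct path))))
  grow (suc s) {D} n≡ path _ edge (no x∉D) =
    walk s (trans n≡ (sym (+-suc s (length D)))) (TightPath-∷ path x∉D edge)

tightPath⇒semicycle : ∀ {n} j {E : List (Subset n)} {D} → All (λ e → ∣ e ∣ ≡ suc j) E →
  SharedRidges E → TightPath j E D → HasSemicycle (suc j) E
tightPath⇒semicycle zero {D = []}    _ _ path = ⊥-elim (1+n≰n (long path))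
tightPath⇒semicycle zero {D = d ∷ _} _ _ path =
  d ∷ [] , refl , here tt , [] ∷ [] , firstEdge path ∷ []
tightPath⇒semicycle {n} (suc i) {D = D} uniform shared path =
  walk uniform shared (n ∸ length D) (sym (m∸n+n≡m (Unique⇒length≤ (distinct path)))) path

sharedRidges⇒semicycle : ∀ {n} j {E : List (Subset n)} → All (λ e → ∣ e ∣ ≡ suc j) E →
  SharedRidges E → ∀ {e} → e ∈ E → HasSemicycle (suc j) E
sharedRidges⇒semicycle j uniform shared e∈E =
  tightPath⇒semicycle j uniform shared (proj₂ (edge⇒TightPath e∈E (All.lookup uniform e∈E)))

-- Pendant vertices and shadow families

Pendant : ∀ {n} → List (Subset n) → Subset n → Fin n → Set
Pendant E e v = v ∈ₛ e × All (λ f → e - v ⊆ f → f ≡ e) E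

pendant? : ∀ {n} (E : List (Subset n)) e v → Dec (Pendant E e v)
pendant? E e v = (v ∈? e) ×-dec All.all? (λ f → (e - v ⊆? f) →-dec ≡-dec _≟ᵇ_ f e) E

pendant-or-sharedRidges : ∀ {n} (E : List (Subset n)) →
  ∃₂ (λ e v → e ∈ E × Pendant E e v) ⊎ SharedRidges E
pendant-or-sharedRidges {n} E with Any.any? (λ e → Any.any? (pendant? E e) (allFin n)) E
... | yes ∃pendant =
  let e , e∈E , ∃v = find ∃pendant
      v , _ , pendant = find ∃v
  in inj₁ (e , v , e∈E , pendant)
... | no ∄pendant = inj₂ shared
  where
  shared : SharedRidges E
  shared {e} e∈E {v} v∈e =
    let f , f∈E , ¬[e-v⊆f→f≡e] = find (¬All⇒Any¬ (λ f → (e - v ⊆? f) →-dec ≡-dec _≟ᵇ_ f e) E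
          (λ maximal → ∄pendant (lose e∈E (lose (∈-allFin v) (v∈e , maximal)))))
    in f , f∈E , (λ f≡e → ¬[e-v⊆f→f≡e] (λ _ → f≡e))
         , decidable-stable (e - v ⊆? f) (λ e-v⊈f → ¬[e-v⊆f→f≡e] (⊥-elim ∘ e-v⊈f))

record ShadowFamily {n} (j : ℕ) (E : List (Subset n)) : Set where
  field
    sets         : List (Subset n)
    sets-unique  : Unique sets
    sets-uniform : All (λ s → ∣ s ∣ ≡ j) sets
    sets-covered : All (λ s → Any (s ⊆_) E) sets
    length-sets  : length sets ≡ length E

addPendant : ∀ {n j} A B {e : Subset n} {v} → Unique (A ++ e ∷ B) →
  All (λ f → ∣ f ∣ ≡ suc j) (A ++ e ∷ B) → Pendant (A ++ e ∷ B) e v →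
  ShadowFamily j (A ++ B) → ShadowFamily j (A ++ e ∷ B)
addPendant A B {e} {v} unique uniform (v∈e , maximal) S = record
  { sets         = (e - v) ∷ sets
  ; sets-unique  = ¬Any⇒All¬ _ e-v∉sets ∷ sets-unique
  ; sets-uniform = suc-injective (trans (x∈p⇒1+∣p-x∣≡∣p∣ v∈e) (All.lookup uniform e∈))
                   ∷ sets-uniform
  ; sets-covered = lose e∈ (p─q⊆p e ⁅ v ⁆) ∷ All.map (Any-resp-⊆ (⊆-insert A)) sets-covered
  ; length-sets  = trans (cong suc length-sets) (sym (length-insert A))
  }
  where
  open ShadowFamily S
  e∈ : e ∈ A ++ e ∷ B
  e∈ = ∈-++⁺ʳ A (here refl)
  e-v∉sets : e - v ∉ sets
  e-v∉sets e-v∈ =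
    let f , f∈ , e-v⊆f = find (All.lookup sets-covered e-v∈)
    in Unique-removed A unique (subst (_∈ A ++ B) (All.lookup maximal (⊆-insert A f∈) e-v⊆f) f∈)

shadowFamily : ∀ {n} j m (E : List (Subset n)) → length E ≡ m → Unique E →
  All (λ e → ∣ e ∣ ≡ suc j) E → ¬ HasSemicycle (suc j) E → ShadowFamily j E
shadowFamily j zero    []      _   _      _       _      = record
  { sets = [] ; sets-unique = [] ; sets-uniform = [] ; sets-covered = [] ; length-sets = refl }
shadowFamily j (suc m) E length≡ unique uniform acyclic with pendant-or-sharedRidges E
... | inj₂ shared =
  ⊥-elim (acyclic (sharedRidges⇒semicycle j uniform shared (proj₂ (∃∈-nonempty length≡))))
... | inj₁ (e , v , e∈E , pendant) with ∈-∃++ e∈E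
...   | A , B , refl = addPendant A B unique uniform pendant
  (shadowFamily j m (A ++ B) (suc-injective (trans (sym (length-insert A)) length≡))
    (Unique-remove A unique) (All.tabulate (All.lookup uniform ∘ ⊆-insert A))
    (λ (vs , closed , nonempty , windows-unique , windows-in) →
       acyclic (vs , closed , nonempty , windows-unique , All.map (⊆-insert A) windows-in)))

-- Counting j-subsets

slice : ∀ {m} → Side → List (Subset (suc m)) → List (Subset m)
slice b []             = []
slice b ((c ∷ p) ∷ S) with c ≟ᵇ b
... | yes _ = p ∷ slice b S
... | no  _ = slice b S

∈-slice⁻ : ∀ {m} b (S : List (Subset (suc m))) {p} → p ∈ slice b S → (b ∷ p) ∈ S
∈-slice⁻ b ((c ∷ q) ∷ S) p∈ with c ≟ᵇ b | p∈
... | yes refl | here refl = here refl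
... | yes refl | there p∈′ = there (∈-slice⁻ b S p∈′)
... | no  _    | p∈′       = there (∈-slice⁻ b S p∈′)

slice-unique : ∀ {m} b {S : List (Subset (suc m))} → Unique S → Unique (slice b S)
slice-unique b {[]}           _          = []
slice-unique b {(c ∷ q) ∷ S} (cq∉S ∷ u) with c ≟ᵇ b
... | yes refl = ¬Any⇒All¬ _ (All¬⇒¬Any cq∉S ∘ ∈-slice⁻ c S) ∷ slice-unique b u
... | no  _    = slice-unique b u

slice-uniform : ∀ {m j} b {S : List (Subset (suc m))} → All (λ s → ∣ s ∣ ≡ j) S →
                All (λ p → ∣ b ∷ p ∣ ≡ j) (slice b S)
slice-uniform b {S} uniform = All.tabulate (All.lookup uniform ∘ ∈-slice⁻ b S)

length-slices : ∀ {m} (S : List (Subset (suc m))) →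
                length S ≡ length (slice inside S) + length (slice outside S)
length-slices []                   = refl
length-slices ((inside  ∷ p) ∷ S) = cong suc (length-slices S)
length-slices ((outside ∷ p) ∷ S) =
  trans (cong suc (length-slices S)) (sym (+-suc (length (slice inside S)) _))

length≤C : ∀ n j {S : List (Subset n)} → Unique S → All (λ s → ∣ s ∣ ≡ j) S → length S ≤ n C j
length≤C zero zero    {[]}          _             _        = z≤n
length≤C zero zero    {[] ∷ []}     _             _        = ≤-refl
length≤C zero zero    {[] ∷ [] ∷ _} ((≢ ∷ _) ∷ _) _        = ⊥-elim (≢ refl)
length≤C zero (suc j) {[]}          _             _        = z≤n
length≤C zero (suc j) {[] ∷ _}      _             (() ∷ _)
-- Both m C 0 and suc m C 0 compute to 1.
length≤C (suc m) zero {S} unique uniform = begin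
  length S
    ≡⟨ length-slices S ⟩
  length (slice inside S) + length (slice outside S)
    ≡⟨ cong (_+ length (slice outside S)) (none (slice-uniform inside uniform)) ⟩
  length (slice outside S)
    ≤⟨ length≤C m zero (slice-unique outside unique) (slice-uniform outside uniform) ⟩
  m C zero
    ∎
  where
  open ≤-Reasoning
  none : ∀ {ps : List (Subset m)} → All (λ p → suc ∣ p ∣ ≡ zero) ps → length ps ≡ zero
  none []      = refl
  none (() ∷ _)
length≤C (suc m) (suc j) {S} unique uniform = begin
  length S
    ≡⟨ length-slices S ⟩
  length (slice inside S) + length (slice outside S)
    ≤⟨ +-mono-≤
         (length≤C m j (slice-unique inside unique)
           (All.map suc-injective (slice-uniform inside uniform)))
         (length≤C m (suc j) (slice-unique outside unique) (slice-uniform outside uniform)) ⟩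
  m C j + m C suc j
    ≡⟨ nCk+nC[k+1]≡[n+1]C[k+1] m j ⟩
  suc m C suc j
    ∎
  where open ≤-Reasoning

mainTheorem10 : (n k : ℕ) → 1 ≤ k → (F : Hypergraph n k) → SemicycleFree F →
    numEdges F ≤ n C (k ∸ 1)
mainTheorem10 n (suc j) _ F semicycleFree =
  subst (_≤ n C j) length-sets (length≤C n j sets-unique sets-uniform)
  where
  open ShadowFamily (shadowFamily j _ (edges F) refl (simple F) (uniform F) semicycleFree)
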